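{- Let $A=(w_1,l_1,\dots,w_n,l_n)$ and $\Delta A=(\Delta w_1,\Delta l_1,\dots,\Delta w_n,\Delta l_n)$ be such that $A'=A+\Delta A$ has all coordinates positive. Let $A'_0$ be any positioning of $A'$ with best packing efficiency, i.e. $\eta(A'_0)=\eta_0(A')$. Then $p(A'_0)\le\sum_{i=1}^n w_i+\sum_{i=1}^n|\Delta w_i|$ and $q(A'_0)\le\sum_{i=1}^n l_i+\sum_{i=1}^n|\Delta l_i|$.
   Context: A vector $A=(w_1,l_1,\dots,w_n,l_n)\in\mathbb{R}_{>0}^{2n}$ is identified with a set of rectangles $A_1,\dots,A_n$, $A_i$ of size $w_i\times l_i$ as an ordered pair (it is not assumed that $w_i\le l_i$). A positioning of $A$ is a placement of these rectangles in the plane with pairwise disjoint interiors, sides parallel to the coordinate axes, and the side of $A_i$ of length $w_i$ parallel to the $x$-axis. If $A_i$ has lower left corner $(x_i^-,y_i^-)$ and upper right corner $(x_i^+,y_i^+)$, set $p(A_M)=\max_{i,j}(x_i^+-x_j^-)$, $q(A_M)=\max_{i,j}(y_i^+-y_j^-)$, $T(A_M)=p(A_M)q(A_M)$, $S(A)=\sum_i w_il_i$, and the packing efficiency $\eta(A_M)=S(A)/T(A_M)$. The best packing efficiency is $\eta_0(A)=\sup\eta(A_M)$ over all positionings $A_M$ of $A$; this supremum is attained. -}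

module Defs where

open import Level using (0ℓ)
open import Data.Nat using (ℕ; zero; suc)
open import Data.Fin using (Fin; zero; suc)
open import Data.Product using (Σ; ∃; _×_; _,_)
open import Data.Sum using (_⊎_)
open import Relation.Nullary using (¬_; Dec; yes; no)
open import Relation.Binary.PropositionalEquality using (_≡_; _≢_)
open import Algebra.Structures using (IsCommutativeRing)

-- The real numbers, given axiomatically as a (Dedekind-)complete,
-- totally ordered field.  Any such structure is isomorphic to ℝ, so
-- quantifying over all of them states the result for ℝ.

record RealField : Set₁ where
  infixl 6 _+_ _-_
  infixl 7 _*_
  infix  4 _≤_ _<_
  field
    ℝ      : Set
    _+_    : ℝ → ℝ → ℝ
    _*_    : ℝ → ℝ → ℝ
    -_     : ℝ → ℝ
    0ℝ     : ℝ
    1ℝ     : ℝ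
    _⁻¹    : ℝ → ℝ
    _≤_    : ℝ → ℝ → Set
    isCommutativeRing : IsCommutativeRing _≡_ _+_ _*_ -_ 0ℝ 1ℝ
    0≢1    : 0ℝ ≢ 1ℝ
    ⁻¹-inverse : ∀ x → x ≢ 0ℝ → x * (x ⁻¹) ≡ 1ℝ
    ≤-refl  : ∀ x → x ≤ x
    ≤-trans : ∀ {x y z} → x ≤ y → y ≤ z → x ≤ z
    ≤-antisym : ∀ {x y} → x ≤ y → y ≤ x → x ≡ y
    ≤-total : ∀ x y → x ≤ y ⊎ y ≤ x
    _≤?_    : ∀ x y → Dec (x ≤ y)
    +-mono-≤ : ∀ {x y} z → x ≤ y → x + z ≤ y + z
    *-nonneg : ∀ {x y} → 0ℝ ≤ x → 0ℝ ≤ y → 0ℝ ≤ x * y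
    sup : (P : ℝ → Set) → (∃ λ x → P x) → (∃ λ b → ∀ x → P x → x ≤ b) →
          ∃ λ s → (∀ x → P x → x ≤ s) × (∀ b → (∀ x → P x → x ≤ b) → s ≤ b)

  _-_ : ℝ → ℝ → ℝ
  x - y = x + (- y)

  _<_ : ℝ → ℝ → Set
  x < y = x ≤ y × x ≢ y

  _/_ : ℝ → ℝ → ℝ
  x / y = x * (y ⁻¹)

  max : ℝ → ℝ → ℝ
  max x y with x ≤? y
  ... | yes _ = y
  ... | no  _ = x

  ∣_∣ : ℝ → ℝ
  ∣ x ∣ = max x (- x)

  Σ[_] : ∀ {n} → (Fin n → ℝ) → ℝ
  Σ[_] {zero}  f = 0ℝ
  Σ[_] {suc n} f = f zero + Σ[_] (λ i → f (suc i))

  Max[_] : ∀ {n} → (Fin (suc n) → ℝ) → ℝ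
  Max[_] {zero}  f = f zero
  Max[_] {suc n} f = max (f zero) (Max[_] (λ i → f (suc i)))

  Positive : ∀ {n} → (Fin n → ℝ) → Set
  Positive v = ∀ i → 0ℝ < v i

  record Positioning {n} (w l : Fin n → ℝ) : Set where
    field
      x : Fin n → ℝ
      y : Fin n → ℝ
      disjoint : ∀ i j → i ≢ j → ¬ (∃ λ a → ∃ λ b →
                   (x i < a × a < x i + w i × y i < b × b < y i + l i) ×
                   (x j < a × a < x j + w j × y j < b × b < y j + l j))

  open Positioning public

  module _ {n} {w l : Fin (suc n) → ℝ} where
    p : Positioning w l → ℝ
    p M = Max[ (λ i → Max[ (λ j → (x M i + w i) - x M j) ]) ]

    q : Positioning w l → ℝ
    q M = Max[ (λ i → Max[ (λ j → (y M i + l i) - y M j) ]) ]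

    T : Positioning w l → ℝ
    T M = p M * q M

    S : ℝ
    S = Σ[ (λ i → w i * l i) ]

    η : Positioning w l → ℝ
    η M = S / T M

    IsBestPositioning : Positioning w l → Set
    IsBestPositioning M =
      (∀ e → (∃ λ (N : Positioning w l) → η N ≡ e) → e ≤ η M) ×
      (∀ b → (∀ e → (∃ λ (N : Positioning w l) → η N ≡ e) → e ≤ b) → η M ≤ b)

-- Slide every rectangle of a positioning horizontally, to the abscissa equal to
-- the total width of the rectangles whose left edge lies strictly left of its
-- own.  Rectangles that were horizontally separated stay separated, and the
-- others keep their vertical positions, so this is again a positioning; its
-- width p is at most Σ wᵢ' and its height q is unchanged.  A best positioning
-- has the least area T = p q among all positionings of A', so its width is at
-- most Σ wᵢ' = Σ (wᵢ + Δwᵢ) ≤ Σ wᵢ + Σ ∣Δwᵢ∣.  The height is handled by the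
-- same argument applied to the transposed positioning.
module Submission where

open import Defs
open import Data.Nat using (ℕ; zero; suc)
open import Data.Fin using (Fin; zero; suc)
open import Data.Product using (_×_; _,_; proj₁; ∃)
open import Data.Sum using (inj₁; inj₂)
open import Data.Empty using (⊥-elim)
open import Function using (_∘_)
open import Relation.Nullary using (¬_; yes; no)
open import Relation.Binary.PropositionalEquality using (_≡_; _≢_; refl; sym; cong; isEquivalence)
open import Relation.Binary.Bundles using (TotalOrder)
open import Algebra.Bundles using (CommutativeRing)
import Algebra.Properties.Ring as RingProperties
import Algebra.Properties.Group as GroupProperties
import Algebra.Properties.CommutativeSemigroup as CommutativeSemigroupProperties
import Relation.Binary.Properties.TotalOrder as TotalOrderProperties
import Relation.Binary.Reasoning.PartialOrder as PartialOrderReasoning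

module OrderedFieldProperties (R : RealField) where
  open RealField R public renaming (+-mono-≤ to +-monoˡ-≤)

  commutativeRing : CommutativeRing _ _
  commutativeRing = record { isCommutativeRing = isCommutativeRing }

  open CommutativeRing commutativeRing public
    using (+-assoc; +-comm; +-identityˡ; +-identityʳ; -‿inverseʳ;
           *-assoc; *-comm; *-identityˡ; *-identityʳ; distribˡ; zeroʳ;
           ring; +-group; +-commutativeSemigroup; *-commutativeSemigroup)
  open RingProperties ring public
    using (-‿distribˡ-*; -‿distribʳ-*; [y-z]x≈yx-zx) renaming (xyx⁻¹≈y to x+y-x≡y)
  open GroupProperties +-group public
    using (//-rightDividesˡ) renaming (∙-cancelˡ to +-cancelˡ; ⁻¹-involutive to -‿involutive)
  open CommutativeSemigroupProperties +-commutativeSemigroup public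
    using () renaming (interchange to +-interchange; xy∙z≈xz∙y to x+y+z≡x+z+y)
  open CommutativeSemigroupProperties *-commutativeSemigroup public
    using () renaming (xy∙z≈xz∙y to x*y*z≡x*z*y)

  totalOrder : TotalOrder _ _ _
  totalOrder = record
    { isTotalOrder = record
      { isPartialOrder = record
        { isPreorder = record
          { isEquivalence = isEquivalence
          ; reflexive = λ { refl → ≤-refl _ }
          ; trans = ≤-trans
          }
        ; antisym = ≤-antisym
        }
      ; total = ≤-total
      }
    }

  open TotalOrder totalOrder public using () renaming (reflexive to ≤-reflexive)
  open TotalOrderProperties totalOrder public using (≰⇒>; <-trans; <⇒≱)
  open PartialOrderReasoning (TotalOrder.poset totalOrder) public

  0≤x⇒-x≤0 : ∀ {x} → 0ℝ ≤ x → - x ≤ 0ℝ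
  0≤x⇒-x≤0 {x} 0≤x = begin
    - x      ≡⟨ +-identityˡ (- x) ⟨
    0ℝ - x   ≤⟨ +-monoˡ-≤ (- x) 0≤x ⟩
    x - x    ≡⟨ -‿inverseʳ x ⟩
    0ℝ       ∎

  x≤0⇒0≤-x : ∀ {x} → x ≤ 0ℝ → 0ℝ ≤ - x
  x≤0⇒0≤-x {x} x≤0 = begin
    0ℝ       ≡⟨ -‿inverseʳ x ⟨
    x - x    ≤⟨ +-monoˡ-≤ (- x) x≤0 ⟩
    0ℝ - x   ≡⟨ +-identityˡ (- x) ⟩
    - x      ∎

  +-monoʳ-≤ : ∀ z {x y} → x ≤ y → z + x ≤ z + y
  +-monoʳ-≤ z {x} {y} x≤y = begin
    z + x  ≡⟨ +-comm z x ⟩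
    x + z  ≤⟨ +-monoˡ-≤ z x≤y ⟩
    y + z  ≡⟨ +-comm y z ⟩
    z + y  ∎

  +-mono-≤ : ∀ {x y u v} → x ≤ y → u ≤ v → x + u ≤ y + v
  +-mono-≤ {y = y} {u = u} x≤y u≤v = ≤-trans (+-monoˡ-≤ u x≤y) (+-monoʳ-≤ y u≤v)

  +-monoʳ-< : ∀ z {x y} → x < y → z + x < z + y
  +-monoʳ-< z {x} {y} (x≤y , x≢y) = +-monoʳ-≤ z x≤y , x≢y ∘ +-cancelˡ z x y

  +-monoˡ-< : ∀ z {x y} → x < y → x + z < y + z
  +-monoˡ-< z {x} {y} x<y = begin-strict
    x + z  ≡⟨ +-comm x z ⟩
    z + x  <⟨ +-monoʳ-< z x<y ⟩
    z + y  ≡⟨ +-comm z y ⟩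
    y + z  ∎

  x≤x+y : ∀ x {y} → 0ℝ ≤ y → x ≤ x + y
  x≤x+y x {y} 0≤y = begin
    x       ≡⟨ +-identityʳ x ⟨
    x + 0ℝ  ≤⟨ +-monoʳ-≤ x 0≤y ⟩
    x + y   ∎

  x<x+y : ∀ x {y} → 0ℝ < y → x < x + y
  x<x+y x {y} 0<y = begin-strict
    x       ≡⟨ +-identityʳ x ⟨
    x + 0ℝ  <⟨ +-monoʳ-< x 0<y ⟩
    x + y   ∎

  x-y≤x : ∀ x {y} → 0ℝ ≤ y → x - y ≤ x
  x-y≤x x {y} 0≤y = begin
    x - y   ≤⟨ +-monoʳ-≤ x (0≤x⇒-x≤0 0≤y) ⟩
    x + 0ℝ  ≡⟨ +-identityʳ x ⟩
    x       ∎

  *-monoˡ-≤ : ∀ {z x y} → 0ℝ ≤ z → x ≤ y → x * z ≤ y * z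
  *-monoˡ-≤ {z} {x} {y} 0≤z x≤y = begin
    x * z                    ≡⟨ +-identityˡ (x * z) ⟨
    0ℝ + x * z               ≤⟨ +-monoˡ-≤ (x * z) (*-nonneg 0≤y-x 0≤z) ⟩
    (y - x) * z + x * z      ≡⟨ cong (_+ x * z) ([y-z]x≈yx-zx z y x) ⟩
    (y * z - x * z) + x * z  ≡⟨ //-rightDividesˡ (x * z) (y * z) ⟩
    y * z                    ∎
    where
    0≤y-x : 0ℝ ≤ y - x
    0≤y-x = ≤-trans (≤-reflexive (sym (-‿inverseʳ x))) (+-monoˡ-≤ (- x) x≤y)

  x*x-nonneg : ∀ x → 0ℝ ≤ x * x
  x*x-nonneg x with ≤-total 0ℝ x
  ... | inj₁ 0≤x = *-nonneg 0≤x 0≤x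
  ... | inj₂ x≤0 = ≤-trans (*-nonneg (x≤0⇒0≤-x x≤0) (x≤0⇒0≤-x x≤0)) (≤-reflexive -x*-x≡x*x)
    where
    -x*-x≡x*x : - x * - x ≡ x * x
    -x*-x≡x*x = begin-equality
      - x * - x      ≡⟨ -‿distribˡ-* x (- x) ⟨
      - (x * - x)    ≡⟨ cong -_ (-‿distribʳ-* x x) ⟨
      - - (x * x)    ≡⟨ -‿involutive (x * x) ⟩
      x * x          ∎

  0<1 : 0ℝ < 1ℝ
  0<1 = ≤-trans (x*x-nonneg 1ℝ) (≤-reflexive (*-identityʳ 1ℝ)) , 0≢1

  positive⇒≢0 : ∀ {x} → 0ℝ < x → x ≢ 0ℝ
  positive⇒≢0 (_ , 0≢x) x≡0 = 0≢x (sym x≡0)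

  x*y/y≡x : ∀ x {y} → 0ℝ < y → (x * y) / y ≡ x
  x*y/y≡x x {y} 0<y = begin-equality
    (x * y) * y ⁻¹   ≡⟨ *-assoc x y (y ⁻¹) ⟩
    x * (y * y ⁻¹)   ≡⟨ cong (x *_) (⁻¹-inverse y (positive⇒≢0 0<y)) ⟩
    x * 1ℝ           ≡⟨ *-identityʳ x ⟩
    x                ∎

  x/y*y≡x : ∀ x {y} → 0ℝ < y → (x / y) * y ≡ x
  x/y*y≡x x {y} 0<y = begin-equality
    (x * y ⁻¹) * y   ≡⟨ x*y*z≡x*z*y x (y ⁻¹) y ⟩
    (x * y) * y ⁻¹   ≡⟨ x*y/y≡x x 0<y ⟩
    x                ∎

  ⁻¹-positive : ∀ {x} → 0ℝ < x → 0ℝ < x ⁻¹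
  ⁻¹-positive {x} 0<x@(0≤x , _) = 0≤x⁻¹ , x⁻¹≢0 ∘ sym
    where
    x⁻¹≢0 : x ⁻¹ ≢ 0ℝ
    x⁻¹≢0 x⁻¹≡0 = 0≢1 (begin-equality
      0ℝ          ≡⟨ zeroʳ x ⟨
      x * 0ℝ      ≡⟨ cong (x *_) x⁻¹≡0 ⟨
      x * x ⁻¹    ≡⟨ ⁻¹-inverse x (positive⇒≢0 0<x) ⟩
      1ℝ          ∎)
    0≤x⁻¹ : 0ℝ ≤ x ⁻¹
    0≤x⁻¹ = begin
      0ℝ                    ≤⟨ *-nonneg 0≤x (x*x-nonneg (x ⁻¹)) ⟩
      x * (x ⁻¹ * x ⁻¹)     ≡⟨ *-assoc x (x ⁻¹) (x ⁻¹) ⟨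
      (x * x ⁻¹) * x ⁻¹     ≡⟨ cong (_* x ⁻¹) (⁻¹-inverse x (positive⇒≢0 0<x)) ⟩
      1ℝ * x ⁻¹             ≡⟨ *-identityˡ (x ⁻¹) ⟩
      x ⁻¹                  ∎

  <-≤-trans : ∀ {x y z} → x < y → y ≤ z → x < z
  <-≤-trans {x} {y} {z} x<y y≤z = begin-strict x <⟨ x<y ⟩ y ≤⟨ y≤z ⟩ z ∎

  ≤-<-trans : ∀ {x y z} → x ≤ y → y < z → x < z
  ≤-<-trans {x} {y} {z} x≤y y<z = begin-strict x ≤⟨ x≤y ⟩ y <⟨ y<z ⟩ z ∎

  *-positive : ∀ {x y} → 0ℝ < x → 0ℝ < y → 0ℝ < x * y
  *-positive {x} {y} 0<x@(0≤x , _) 0<y@(0≤y , _) = *-nonneg 0≤x 0≤y , x*y≢0 ∘ sym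
    where
    x*y≢0 : x * y ≢ 0ℝ
    x*y≢0 x*y≡0 = positive⇒≢0 0<x (begin-equality
      x                ≡⟨ x*y/y≡x x 0<y ⟨
      (x * y) * y ⁻¹   ≡⟨ cong (_* y ⁻¹) x*y≡0 ⟩
      0ℝ * y ⁻¹        ≡⟨ *-comm 0ℝ (y ⁻¹) ⟩
      y ⁻¹ * 0ℝ        ≡⟨ zeroʳ (y ⁻¹) ⟩
      0ℝ               ∎)

  *-cancelʳ-≤ : ∀ {z x y} → 0ℝ < z → x * z ≤ y * z → x ≤ y
  *-cancelʳ-≤ {z} {x} {y} 0<z xz≤yz = begin
    x                ≡⟨ x*y/y≡x x 0<z ⟨
    (x * z) * z ⁻¹   ≤⟨ *-monoˡ-≤ (proj₁ (⁻¹-positive 0<z)) xz≤yz ⟩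
    (y * z) * z ⁻¹   ≡⟨ x*y/y≡x y 0<z ⟩
    y                ∎

  *-cancelˡ-≤ : ∀ {z x y} → 0ℝ < z → z * x ≤ z * y → x ≤ y
  *-cancelˡ-≤ {z} {x} {y} 0<z zx≤zy = *-cancelʳ-≤ 0<z (begin
    x * z   ≡⟨ *-comm x z ⟩
    z * x   ≤⟨ zx≤zy ⟩
    z * y   ≡⟨ *-comm z y ⟩
    y * z   ∎)

  *-monoˡ-< : ∀ {z x y} → 0ℝ < z → x < y → x * z < y * z
  *-monoˡ-< {z} {x} {y} 0<z (x≤y , x≢y) = *-monoˡ-≤ (proj₁ 0<z) x≤y , x≢y ∘ cancel
    where
    cancel : x * z ≡ y * z → x ≡ y
    cancel xz≡yz = begin-equality
      x                ≡⟨ x*y/y≡x x 0<z ⟨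
      (x * z) * z ⁻¹   ≡⟨ cong (_* z ⁻¹) xz≡yz ⟩
      (y * z) * z ⁻¹   ≡⟨ x*y/y≡x y 0<z ⟩
      y                ∎

  s/a≤s/b⇒b≤a : ∀ {s a b} → 0ℝ < s → 0ℝ < a → 0ℝ < b → s / a ≤ s / b → b ≤ a
  s/a≤s/b⇒b≤a {s} {a} {b} 0<s 0<a 0<b s/a≤s/b = *-cancelˡ-≤ 0<s (begin
    s * b               ≡⟨ cong (_* b) (x/y*y≡x s 0<a) ⟨
    ((s / a) * a) * b   ≤⟨ *-monoˡ-≤ (proj₁ 0<b) (*-monoˡ-≤ (proj₁ 0<a) s/a≤s/b) ⟩
    ((s / b) * a) * b   ≡⟨ x*y*z≡x*z*y (s / b) a b ⟩
    ((s / b) * b) * a   ≡⟨ cong (_* a) (x/y*y≡x s 0<b) ⟩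
    s * a               ∎)

  midpoint : ∀ {x y} → x < y → ∃ λ m → x < m × m < y
  midpoint {x} {y} x<y = (x + y) / two , x<m , m<y
    where
    two : ℝ
    two = 1ℝ + 1ℝ
    0<two : 0ℝ < two
    0<two = <-≤-trans 0<1 (x≤x+y 1ℝ (proj₁ 0<1))
    halve : ∀ u → (u + u) / two ≡ u
    halve u = begin-equality
      (u + u) / two          ≡⟨ cong (λ v → (v + v) / two) (*-identityʳ u) ⟨
      (u * 1ℝ + u * 1ℝ) / two ≡⟨ cong (_/ two) (distribˡ u 1ℝ 1ℝ) ⟨
      (u * two) / two        ≡⟨ x*y/y≡x u 0<two ⟩
      u                      ∎
    x<m : x < (x + y) / two
    x<m = begin-strict
      x              ≡⟨ halve x ⟨
      (x + x) / two  <⟨ *-monoˡ-< (⁻¹-positive 0<two) (+-monoʳ-< x x<y) ⟩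
      (x + y) / two  ∎
    m<y : (x + y) / two < y
    m<y = begin-strict
      (x + y) / two  <⟨ *-monoˡ-< (⁻¹-positive 0<two) (+-monoˡ-< y x<y) ⟩
      (y + y) / two  ≡⟨ halve y ⟩
      y              ∎

  open-intervals-meet-between : ∀ {a b c d lo hi} → a ≤ lo → c ≤ lo → hi ≤ b → hi ≤ d → lo < hi →
                                ∃ λ m → (a < m × m < b) × (c < m × m < d)
  open-intervals-meet-between a≤lo c≤lo hi≤b hi≤d lo<hi with midpoint lo<hi
  ... | m , lo<m , m<hi =
    m , (≤-<-trans a≤lo lo<m , <-≤-trans m<hi hi≤b) , (≤-<-trans c≤lo lo<m , <-≤-trans m<hi hi≤d)

  open-intervals-meet : ∀ {a b c d} → a < b → c < d → a < d → c < b →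
                        ∃ λ m → (a < m × m < b) × (c < m × m < d)
  open-intervals-meet {a} {b} {c} {d} a<b c<d a<d c<b with ≤-total a c | ≤-total b d
  ... | inj₁ a≤c | inj₁ b≤d = open-intervals-meet-between a≤c (≤-refl c) (≤-refl b) b≤d c<b
  ... | inj₁ a≤c | inj₂ d≤b = open-intervals-meet-between a≤c (≤-refl c) d≤b (≤-refl d) c<d
  ... | inj₂ c≤a | inj₁ b≤d = open-intervals-meet-between (≤-refl a) c≤a (≤-refl b) b≤d a<b
  ... | inj₂ c≤a | inj₂ d≤b = open-intervals-meet-between (≤-refl a) c≤a d≤b (≤-refl d) a<d

  max-ubˡ : ∀ x y → x ≤ max x y
  max-ubˡ x y with x ≤? y
  ... | yes x≤y = x≤y
  ... | no  _   = ≤-refl x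

  max-ubʳ : ∀ x y → y ≤ max x y
  max-ubʳ x y with x ≤? y
  ... | yes _   = ≤-refl y
  ... | no  x≰y = proj₁ (≰⇒> x≰y)

  max-lub : ∀ {x y z} → x ≤ z → y ≤ z → max x y ≤ z
  max-lub {x} {y} x≤z y≤z with x ≤? y
  ... | yes _ = y≤z
  ... | no  _ = x≤z

  x≤∣x∣ : ∀ x → x ≤ ∣ x ∣
  x≤∣x∣ x = max-ubˡ x (- x)

  Max-ub : ∀ {n} (f : Fin (suc n) → ℝ) i → f i ≤ Max[ f ]
  Max-ub {zero} f zero    = ≤-refl (f zero)
  Max-ub {suc n}  f zero    = max-ubˡ (f zero) _
  Max-ub {suc n}  f (suc i) = ≤-trans (Max-ub (f ∘ suc) i) (max-ubʳ (f zero) _)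

  Max-lub : ∀ {n} (f : Fin (suc n) → ℝ) {z} → (∀ i → f i ≤ z) → Max[ f ] ≤ z
  Max-lub {zero} f f≤z = f≤z zero
  Max-lub {suc n}  f f≤z = max-lub (f≤z zero) (Max-lub (f ∘ suc) (f≤z ∘ suc))

  Σ-nonneg : ∀ {n} (f : Fin n → ℝ) → (∀ i → 0ℝ ≤ f i) → 0ℝ ≤ Σ[ f ]
  Σ-nonneg {zero} f 0≤f = ≤-refl 0ℝ
  Σ-nonneg {suc n}  f 0≤f =
    ≤-trans (≤-reflexive (sym (+-identityˡ 0ℝ))) (+-mono-≤ (0≤f zero) (Σ-nonneg (f ∘ suc) (0≤f ∘ suc)))

  Σ-positive : ∀ {n} (f : Fin (suc n) → ℝ) → (∀ i → 0ℝ < f i) → 0ℝ < Σ[ f ]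
  Σ-positive f 0<f = <-≤-trans (0<f zero) (x≤x+y (f zero) (Σ-nonneg (f ∘ suc) (proj₁ ∘ 0<f ∘ suc)))

  Σ-mono-≤ : ∀ {n} {f g : Fin n → ℝ} → (∀ i → f i ≤ g i) → Σ[ f ] ≤ Σ[ g ]
  Σ-mono-≤ {zero} f≤g = ≤-refl 0ℝ
  Σ-mono-≤ {suc n}  f≤g = +-mono-≤ (f≤g zero) (Σ-mono-≤ (f≤g ∘ suc))

  Σ-mono-≤-slack : ∀ {n} {f g : Fin n → ℝ} j {c} → (∀ i → f i ≤ g i) → f j + c ≤ g j →
                   Σ[ f ] + c ≤ Σ[ g ]
  Σ-mono-≤-slack {f = f} {g} zero {c} f≤g fj+c≤gj = begin
    (f zero + Σ[ f ∘ suc ]) + c   ≡⟨ x+y+z≡x+z+y (f zero) _ c ⟩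
    (f zero + c) + Σ[ f ∘ suc ]   ≤⟨ +-mono-≤ fj+c≤gj (Σ-mono-≤ (f≤g ∘ suc)) ⟩
    g zero + Σ[ g ∘ suc ]         ∎
  Σ-mono-≤-slack {f = f} {g} (suc j) {c} f≤g fj+c≤gj = begin
    (f zero + Σ[ f ∘ suc ]) + c   ≡⟨ +-assoc (f zero) _ c ⟩
    f zero + (Σ[ f ∘ suc ] + c)   ≤⟨ +-mono-≤ (f≤g zero) (Σ-mono-≤-slack j (f≤g ∘ suc) fj+c≤gj) ⟩
    g zero + Σ[ g ∘ suc ]         ∎

  Σ-+ : ∀ {n} (f g : Fin n → ℝ) → Σ[ (λ i → f i + g i) ] ≡ Σ[ f ] + Σ[ g ]
  Σ-+ {zero} f g = sym (+-identityˡ 0ℝ)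
  Σ-+ {suc n}  f g = begin-equality
    (f zero + g zero) + Σ[ (λ i → f (suc i) + g (suc i)) ] ≡⟨ cong (f zero + g zero +_) (Σ-+ (f ∘ suc) (g ∘ suc)) ⟩
    (f zero + g zero) + (Σ[ f ∘ suc ] + Σ[ g ∘ suc ])      ≡⟨ +-interchange (f zero) (g zero) _ _ ⟩
    (f zero + Σ[ f ∘ suc ]) + (g zero + Σ[ g ∘ suc ])      ∎

  Σ[u+v]≤Σ[u]+Σ[∣v∣] : ∀ {n} (u v : Fin n → ℝ) → Σ[ (λ i → u i + v i) ] ≤ Σ[ u ] + Σ[ (λ i → ∣ v i ∣) ]
  Σ[u+v]≤Σ[u]+Σ[∣v∣] u v = begin
    Σ[ (λ i → u i + v i) ]          ≡⟨ Σ-+ u v ⟩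
    Σ[ u ] + Σ[ v ]                 ≤⟨ +-monoʳ-≤ Σ[ u ] (Σ-mono-≤ (x≤∣x∣ ∘ v)) ⟩
    Σ[ u ] + Σ[ (λ i → ∣ v i ∣) ]  ∎

module Packing (R : RealField) where
  open OrderedFieldProperties R

  transpose : ∀ {n} {W L : Fin n → ℝ} → Positioning W L → Positioning L W
  transpose M = record
    { x = y M
    ; y = x M
    ; disjoint = λ { i j i≢j (b , a , (bi₁ , bi₂ , ai₁ , ai₂) , (bj₁ , bj₂ , aj₁ , aj₂)) →
        disjoint M i j i≢j (a , b , (ai₁ , ai₂ , bi₁ , bi₂) , (aj₁ , aj₂ , bj₁ , bj₂)) }
    }

  module PackLeft {n} {W L : Fin n → ℝ} (W>0 : Positive W) (M : Positioning W L) where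

    widthIfLeftOf : Fin n → Fin n → ℝ
    widthIfLeftOf i k with x M i ≤? x M k
    ... | yes _ = 0ℝ
    ... | no  _ = W k

    widthIfLeftOf-nonneg : ∀ i k → 0ℝ ≤ widthIfLeftOf i k
    widthIfLeftOf-nonneg i k with x M i ≤? x M k
    ... | yes _ = ≤-refl 0ℝ
    ... | no  _ = proj₁ (W>0 k)

    widthIfLeftOf-≤ : ∀ i k → widthIfLeftOf i k ≤ W k
    widthIfLeftOf-≤ i k with x M i ≤? x M k
    ... | yes _ = proj₁ (W>0 k)
    ... | no  _ = ≤-refl (W k)

    widthIfLeftOf-self : ∀ i → widthIfLeftOf i i ≡ 0ℝ
    widthIfLeftOf-self i with x M i ≤? x M i
    ... | yes _    = refl
    ... | no  xi≰xi = ⊥-elim (xi≰xi (≤-refl (x M i)))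

    widthIfLeftOf-left : ∀ {i k} → x M k < x M i → widthIfLeftOf i k ≡ W k
    widthIfLeftOf-left {i} {k} xk<xi with x M i ≤? x M k
    ... | yes xi≤xk = ⊥-elim (<⇒≱ xk<xi xi≤xk)
    ... | no  _     = refl

    widthIfLeftOf-mono : ∀ {i j} → x M j ≤ x M i → ∀ k → widthIfLeftOf j k ≤ widthIfLeftOf i k
    widthIfLeftOf-mono {i} {j} xj≤xi k with x M i ≤? x M k | x M j ≤? x M k
    ... | yes _     | yes _     = ≤-refl 0ℝ
    ... | yes xi≤xk | no  xj≰xk = ⊥-elim (xj≰xk (≤-trans xj≤xi xi≤xk))
    ... | no  _     | yes _     = proj₁ (W>0 k)
    ... | no  _     | no  _     = ≤-refl (W k)

    packedX : Fin n → ℝ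
    packedX i = Σ[ widthIfLeftOf i ]

    packedX-nonneg : ∀ i → 0ℝ ≤ packedX i
    packedX-nonneg i = Σ-nonneg (widthIfLeftOf i) (widthIfLeftOf-nonneg i)

    packedX+W≤ΣW : ∀ i → packedX i + W i ≤ Σ[ W ]
    packedX+W≤ΣW i = Σ-mono-≤-slack i (widthIfLeftOf-≤ i) (begin
      widthIfLeftOf i i + W i   ≡⟨ cong (_+ W i) (widthIfLeftOf-self i) ⟩
      0ℝ + W i                  ≡⟨ +-identityˡ (W i) ⟩
      W i                       ∎)

    packedX-separated : ∀ {i j} → x M j + W j ≤ x M i → packedX j + W j ≤ packedX i
    packedX-separated {i} {j} ej≤xi = Σ-mono-≤-slack j (widthIfLeftOf-mono xj≤xi) (begin
      widthIfLeftOf j j + W j   ≡⟨ cong (_+ W j) (widthIfLeftOf-self j) ⟩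
      0ℝ + W j                  ≡⟨ +-identityˡ (W j) ⟩
      W j                       ≡⟨ widthIfLeftOf-left xj<xi ⟨
      widthIfLeftOf i j         ∎)
      where
      xj<xi : x M j < x M i
      xj<xi = <-≤-trans (x<x+y (x M j) (W>0 j)) ej≤xi
      xj≤xi : x M j ≤ x M i
      xj≤xi = proj₁ xj<xi

    packLeft : Positioning W L
    packLeft = record { x = packedX ; y = y M ; disjoint = packed-disjoint }
      where
      packed-disjoint : ∀ i j → i ≢ j → ¬ (∃ λ a → ∃ λ b →
        (packedX i < a × a < packedX i + W i × y M i < b × b < y M i + L i) ×
        (packedX j < a × a < packedX j + W j × y M j < b × b < y M j + L j))
      packed-disjoint i j i≢j (a , b , (xi<a , a<ei , yi<b , b<fi) , (xj<a , a<ej , yj<b , b<fj))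
        with (x M j + W j) ≤? x M i | (x M i + W i) ≤? x M j
      ... | yes ej≤xi | _ = <⇒≱ (<-trans xi<a a<ej) (packedX-separated ej≤xi)
      ... | no  _ | yes ei≤xj = <⇒≱ (<-trans xj<a a<ei) (packedX-separated ei≤xj)
      ... | no  ej≰xi | no  ei≰xj
        with open-intervals-meet (x<x+y (x M i) (W>0 i)) (x<x+y (x M j) (W>0 j)) (≰⇒> ej≰xi) (≰⇒> ei≰xj)
      ... | m , (xi<m , m<ei) , (xj<m , m<ej) =
        disjoint M i j i≢j (m , b , (xi<m , m<ei , yi<b , b<fi) , (xj<m , m<ej , yj<b , b<fj))

  open PackLeft using (packLeft)

  p-packLeft≤ΣW : ∀ {n} {W L : Fin (suc n) → ℝ} (W>0 : Positive W) (M : Positioning W L) →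
                  p (packLeft W>0 M) ≤ Σ[ W ]
  p-packLeft≤ΣW {W = W} W>0 M = Max-lub _ λ i → Max-lub _ λ j → begin
    (packedX i + W i) - packedX j   ≤⟨ x-y≤x _ (packedX-nonneg j) ⟩
    packedX i + W i                 ≤⟨ packedX+W≤ΣW i ⟩
    Σ[ W ]                          ∎
    where open PackLeft W>0 M

  p-positive : ∀ {n} {W L : Fin (suc n) → ℝ} → Positive W → (M : Positioning W L) → 0ℝ < p M
  p-positive {W = W} W>0 M = begin-strict
    0ℝ                                         <⟨ W>0 zero ⟩
    W zero                                     ≡⟨ x+y-x≡y (x M zero) (W zero) ⟨
    (x M zero + W zero) - x M zero             ≤⟨ Max-ub (λ j → (x M zero + W zero) - x M j) zero ⟩
    Max[ (λ j → (x M zero + W zero) - x M j) ] ≤⟨ Max-ub (λ i → Max[ (λ j → (x M i + W i) - x M j) ]) zero ⟩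
    p M                                        ∎

  module _ {n} {W L : Fin (suc n) → ℝ} where

    q-positive : Positive L → (M : Positioning W L) → 0ℝ < q M
    q-positive L>0 M = p-positive L>0 (transpose M)

    T-positive : Positive W → Positive L → (M : Positioning W L) → 0ℝ < T M
    T-positive W>0 L>0 M = *-positive (p-positive W>0 M) (q-positive L>0 M)

    best⇒T-minimal : Positive W → Positive L → (M : Positioning W L) → IsBestPositioning M →
                     (N : Positioning W L) → T M ≤ T N
    best⇒T-minimal W>0 L>0 M (η≤ηM , _) N =
      s/a≤s/b⇒b≤a S>0 (T-positive W>0 L>0 N) (T-positive W>0 L>0 M) (η≤ηM (η N) (N , refl))
      where
      S>0 : 0ℝ < S {n} {W} {L}
      S>0 = Σ-positive _ (λ i → *-positive (W>0 i) (L>0 i))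

    best⇒p≤ΣW : Positive W → Positive L → (M : Positioning W L) → IsBestPositioning M → p M ≤ Σ[ W ]
    best⇒p≤ΣW W>0 L>0 M best = begin
      p M                   ≤⟨ *-cancelʳ-≤ (q-positive L>0 M) (best⇒T-minimal W>0 L>0 M best N) ⟩
      p N                   ≤⟨ p-packLeft≤ΣW W>0 M ⟩
      Σ[ W ]                ∎
      where
      N : Positioning W L
      N = packLeft W>0 M

    best⇒q≤ΣL : Positive W → Positive L → (M : Positioning W L) → IsBestPositioning M → q M ≤ Σ[ L ]
    best⇒q≤ΣL W>0 L>0 M best = begin
      q M                   ≤⟨ *-cancelˡ-≤ (p-positive W>0 M) (best⇒T-minimal W>0 L>0 M best N) ⟩
      q N                   ≤⟨ p-packLeft≤ΣW L>0 (transpose M) ⟩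
      Σ[ L ]                ∎
      where
      N : Positioning W L
      N = transpose (packLeft L>0 (transpose M))

lemma2 : (R : RealField) → let open RealField R in
    (n : ℕ) (w l Δw Δl : Fin (suc n) → ℝ) →
    Positive w → Positive l →
    Positive (λ i → w i + Δw i) → Positive (λ i → l i + Δl i) →
    (M : Positioning (λ i → w i + Δw i) (λ i → l i + Δl i)) →
    IsBestPositioning M →
    (p M ≤ Σ[ w ] + Σ[ (λ i → ∣ Δw i ∣) ]) ×
    (q M ≤ Σ[ l ] + Σ[ (λ i → ∣ Δl i ∣) ])
lemma2 R n w l Δw Δl _ _ w′>0 l′>0 M best =
    ≤-trans (best⇒p≤ΣW w′>0 l′>0 M best) (Σ[u+v]≤Σ[u]+Σ[∣v∣] w Δw)
  , ≤-trans (best⇒q≤ΣL w′>0 l′>0 M best) (Σ[u+v]≤Σ[u]+Σ[∣v∣] l Δl)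
  where
  open Packing R
  open OrderedFieldProperties R
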